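{- Let $G$ be a finite simple undirected graph and $g$ a positive integer. If the procedure Burn-Guess$(G,g)$ returns Bad-Guess, then there is no burning schedule for $G$ that burns $G$ in fewer than $g$ rounds.
   Context: Graph burning: rounds $1,2,\dots$; initially nothing burns; in each round every neighbour of a burning vertex becomes burning and a new fire is started at a chosen non-burning vertex (the activator). A schedule is the sequence of activators; its number of rounds is the round at which all vertices are first burning. Procedure Burn-Guess$(G,g)$: it processes the vertices of $G$ one by one in an arbitrary order, maintaining a set of centers, initially empty. When a vertex $v$ is processed, if $v$ is at distance at most $2g-2$ from some current center it is marked non-center; otherwise $v$ is added to the set of centers. If after processing any vertex the number of centers equals $g$, the procedure stops and returns Bad-Guess. If all vertices are processed without this happening, it returns the burning sequence consisting of the centers in an arbitrary order (the $i$-th center is the activator of round $i$). -}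

module Defs where

open import Data.Nat using (ℕ; zero; suc; _*_; _∸_)
open import Data.Fin using (Fin)
open import Data.List using (List; []; _∷_; length; reverse)
open import Data.List.Relation.Unary.Any using (Any)
open import Data.Product using (Σ; _×_)
open import Data.Sum using (_⊎_)
open import Data.Empty using (⊥)
open import Data.Unit using (⊤)
open import Relation.Nullary using (¬_)
open import Relation.Binary.PropositionalEquality using (_≡_; _≢_)

record Graph (n : ℕ) : Set₁ where
  field
    Adj     : Fin n → Fin n → Set
    sym     : ∀ {u v} → Adj u v → Adj v u
    irrefl  : ∀ {u} → ¬ Adj u u
open Graph public

module _ {n : ℕ} (G : Graph n) where

  data WithinDist : ℕ → Fin n → Fin n → Set where
    here  : ∀ {d u} → WithinDist d u u
    there : ∀ {d u w v} → Adj G u w → WithinDist d w v → WithinDist (suc d) u v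

  -- Graph burning.  Activators are given as a list in REVERSE chronological
  -- order (latest round first) for the recursive definitions below.

  -- BurningRev xs v : v is burning at the end of round (length xs).
  -- SpreadRev xs v  : v is burning after the spreading step of round
  --                   (length xs + 1), before the new fire is started.
  BurningRev : List (Fin n) → Fin n → Set
  SpreadRev  : List (Fin n) → Fin n → Set
  BurningRev []       v = ⊥
  BurningRev (x ∷ xs) v = SpreadRev xs v ⊎ v ≡ x
  SpreadRev xs v = BurningRev xs v ⊎ Σ (Fin n) (λ u → BurningRev xs u × Adj G u v)

  -- Each activator must be a non-burning vertex (after spreading in its
  -- round); the only exception is a round in which, after spreading, every
  -- vertex already burns (then no fresh fire can/need be started).
  ValidRev : List (Fin n) → Set
  ValidRev []       = ⊤
  ValidRev (x ∷ xs) = ValidRev xs × ((∀ v → SpreadRev xs v) ⊎ ¬ SpreadRev xs x)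

  -- Chronological versions: s = (x₁, x₂, …, x_T), x_i activator of round i.
  ValidSchedule : List (Fin n) → Set
  ValidSchedule s = ValidRev (reverse s)

  BurnsAll : List (Fin n) → Set
  BurnsAll s = ∀ v → BurningRev (reverse s) v

  BurnableInFewerThan : ℕ → Set
  BurnableInFewerThan g =
    Σ (List (Fin n)) (λ s → length s Data.Nat.< g × ValidSchedule s × BurnsAll s)

  data Outcome : Set where
    badGuess : Outcome
    sequence : List (Fin n) → Outcome

  NearCenter : ℕ → List (Fin n) → Fin n → Set
  NearCenter g cs v = Any (λ c → WithinDist (2 * g ∸ 2) c v) cs

  -- Run g vs cs o : processing the remaining vertices vs (in this order)
  -- with current set of centers cs produces outcome o.
  data Run (g : ℕ) : List (Fin n) → List (Fin n) → Outcome → Set where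
    finish  : ∀ {cs} → Run g [] cs (sequence cs)
    skip    : ∀ {v vs cs o} → NearCenter g cs v → Run g vs cs o → Run g (v ∷ vs) cs o
    addStop : ∀ {v vs cs} → ¬ NearCenter g cs v → suc (length cs) ≡ g →
              Run g (v ∷ vs) cs badGuess
    addGo   : ∀ {v vs cs o} → ¬ NearCenter g cs v → suc (length cs) ≢ g →
              Run g vs (v ∷ cs) o → Run g (v ∷ vs) cs o

  BurnGuessBad : ℕ → List (Fin n) → Set
  BurnGuessBad g order = Run g order [] badGuess

-- A vertex burning after T rounds lies within distance T of some activator.
-- A Bad-Guess run exhibits g centers pairwise more than 2g − 2 apart, so no
-- activator lies within distance g − 1 of two of them.  A schedule of T < g
-- rounds has only T activators, so by pigeonhole two centers share one, and
-- they would be at distance at most 2T ≤ 2g − 2.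
module Submission where

open import Defs
open import Data.Nat using (ℕ; suc; _+_; _*_; _∸_; _≤_; _<_; s≤s)
open import Data.Nat.Properties using (≮⇒≥; n≤1+n; m≤n+m; +-mono-≤; +-identityʳ; +-suc; <⇒≱)
open import Data.Fin using (Fin) renaming (zero to fzero; suc to fsuc; _<_ to _<ᶠ_)
open import Data.Fin.Properties using (pigeonhole)
open import Data.List using (List; _∷_; length; reverse; lookup; allFin)
open import Data.List.Properties using (length-reverse)
open import Data.List.Membership.Propositional.Properties using (∈-lookup)
open import Data.List.Relation.Binary.Permutation.Propositional using (_↭_)
import Data.List.Relation.Unary.Any as Any
open Any using (Any; here; there; index)
open import Data.List.Relation.Unary.Any.Properties using (lookup-index)
import Data.List.Relation.Unary.All as All
open All using (All)
open import Data.List.Relation.Unary.All.Properties.Core using (¬Any⇒All¬)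
open import Data.List.Relation.Unary.AllPairs using (AllPairs; []; _∷_)
open import Data.Product using (∃-syntax; _×_; _,_)
open import Data.Sum using (inj₁; inj₂)
open import Relation.Nullary using (¬_; contraposition)
open import Relation.Binary.PropositionalEquality as ≡ using (_≡_; refl; subst)
open import Function using (_∘_)

AllPairs-lookup : ∀ {A : Set} {R : A → A → Set} {xs : List A} → AllPairs R xs →
                  ∀ {i j : Fin (length xs)} → i <ᶠ j → R (lookup xs i) (lookup xs j)
AllPairs-lookup {xs = _ ∷ xs} (r ∷ _)  {fzero}  {fsuc j} _       = All.lookup r (∈-lookup {xs = xs} j)
AllPairs-lookup               (_ ∷ rs) {fsuc i} {fsuc j} (s≤s i<j) = AllPairs-lookup rs i<j

m<n⇒m+m≤2*n∸2 : ∀ {m n} → m < n → m + m ≤ 2 * n ∸ 2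
m<n⇒m+m≤2*n∸2 {m} {suc n} (s≤s m≤n) rewrite +-identityʳ n | +-suc n n = +-mono-≤ m≤n m≤n

module _ {n : ℕ} (G : Graph n) where

  WithinDist-mono : ∀ {d d′ u v} → d ≤ d′ → WithinDist G d u v → WithinDist G d′ u v
  WithinDist-mono _          here         = here
  WithinDist-mono (s≤s d≤d′) (there a w) = there a (WithinDist-mono d≤d′ w)

  WithinDist-snoc : ∀ {d u w v} → WithinDist G d u w → Adj G w v → WithinDist G (suc d) u v
  WithinDist-snoc here        a = there a here
  WithinDist-snoc (there b w) a = there b (WithinDist-snoc w a)

  WithinDist-sym : ∀ {d u v} → WithinDist G d u v → WithinDist G d v u
  WithinDist-sym here        = here
  WithinDist-sym (there a w) = WithinDist-snoc (WithinDist-sym w) (Graph.sym G a)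

  WithinDist-trans : ∀ {d e u w v} → WithinDist G d u w → WithinDist G e w v →
                     WithinDist G (d + e) u v
  WithinDist-trans {d} {e} here w = WithinDist-mono (m≤n+m e d) w
  WithinDist-trans (there a w₁) w₂ = there a (WithinDist-trans w₁ w₂)

  BurningRev⇒near-activator : ∀ xs v → BurningRev G xs v → Any (WithinDist G (length xs) v) xs
  SpreadRev⇒near-activator  : ∀ xs v → SpreadRev G xs v → Any (WithinDist G (suc (length xs)) v) xs
  BurningRev⇒near-activator (x ∷ xs) v (inj₁ s)    = there (SpreadRev⇒near-activator xs v s)
  BurningRev⇒near-activator (x ∷ xs) v (inj₂ refl) = here here
  SpreadRev⇒near-activator xs v (inj₁ b) =
    Any.map (WithinDist-mono (n≤1+n _)) (BurningRev⇒near-activator xs v b)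
  SpreadRev⇒near-activator xs v (inj₂ (u , b , a)) =
    Any.map (there (Graph.sym G a)) (BurningRev⇒near-activator xs u b)

  Scattered : ℕ → List (Fin n) → Set
  Scattered d = AllPairs (λ u v → ¬ WithinDist G d u v)

  scattered≤covering : ∀ {d r} {L xs : List (Fin n)} → r + r ≤ d → Scattered d L →
                       (∀ v → Any (WithinDist G r v) xs) → length L ≤ length xs
  scattered≤covering {r = r} {L} {xs} r+r≤d scattered cover =
    ≮⇒≥ λ |xs|<|L| → collision (pigeonhole |xs|<|L| nearest)
    where
      nearest : Fin (length L) → Fin (length xs)
      nearest i = index (cover (lookup L i))

      near : ∀ i → WithinDist G r (lookup L i) (lookup xs (nearest i))
      near i = lookup-index (cover (lookup L i))

      collision : ¬ (∃[ i ] ∃[ j ] i <ᶠ j × nearest i ≡ nearest j)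
      collision (i , j , i<j , same) = AllPairs-lookup scattered i<j
        (WithinDist-mono r+r≤d (WithinDist-trans
          (subst (WithinDist G r (lookup L i) ∘ lookup xs) same (near i))
          (WithinDist-sym (near j))))

  far-from-all : ∀ {d v cs} → ¬ Any (λ c → WithinDist G d c v) cs → All (λ c → ¬ WithinDist G d v c) cs
  far-from-all {cs = cs} far = All.map (contraposition WithinDist-sym) (¬Any⇒All¬ cs far)

  Run-badGuess⇒scattered : ∀ {g vs cs} → Run G g vs cs badGuess → Scattered (2 * g ∸ 2) cs →
                           ∃[ L ] length L ≡ g × Scattered (2 * g ∸ 2) L
  Run-badGuess⇒scattered (skip _ run)           scattered = Run-badGuess⇒scattered run scattered
  Run-badGuess⇒scattered (addStop far |cs|+1≡g) scattered = _ , |cs|+1≡g , far-from-all far ∷ scattered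
  Run-badGuess⇒scattered (addGo far _ run)      scattered =
    Run-badGuess⇒scattered run (far-from-all far ∷ scattered)

lemma2 : ∀ {n : ℕ} (G : Graph n) (g : ℕ) → 1 ≤ g →
         (order : List (Fin n)) → order ↭ allFin n →
         BurnGuessBad G g order → ¬ BurnableInFewerThan G g
lemma2 G g _ _ _ bad (s , |s|<g , _ , burns)
  with L , |L|≡g , scattered ← Run-badGuess⇒scattered G bad [] = <⇒≱ T<g g≤T
  where
    T = length (reverse s)

    T<g : T < g
    T<g = subst (_< g) (≡.sym (length-reverse s)) |s|<g

    g≤T : g ≤ T
    g≤T = subst (_≤ T) |L|≡g (scattered≤covering G (m<n⇒m+m≤2*n∸2 T<g) scattered
            (λ v → BurningRev⇒near-activator G (reverse s) v (burns v)))
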